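{- Let $(\mathcal{D},\sqsubseteq)$ be a poset. (1) The following are equivalent: (a) for every finite nonempty set $\mathcal{G}$ and every map $\delta:\mathcal{G}\to\mathcal{D}$, $(\mathcal{G},(\mathcal{D},\sqsubseteq),\delta)$ is a pattern multistructure; (b) $(\mathcal{D},\sqsubseteq)$ is a meet-multisemilattice with $\mathcal{D}=\downarrow\max(\mathcal{D})$. (2) The following are equivalent: (a) for every nonempty set $\mathcal{G}$ and every map $\delta:\mathcal{G}\to\mathcal{D}$, $(\mathcal{G},(\mathcal{D},\sqsubseteq),\delta)$ is a pattern multistructure; (b) $(\mathcal{D},\sqsubseteq)$ is a complete meet-multisemilattice.
   Context: For $S\subseteq\mathcal{D}$, $S^\ell=\{x\in\mathcal{D}\mid\forall s\in S,\ x\sqsubseteq s\}$ ($\emptyset^\ell=\mathcal{D}$), $\max(X)$ is the set of maximal elements of $X$, and $\downarrow X=\{y\in\mathcal{D}\mid\exists x\in X,\ y\sqsubseteq x\}$. $S$ has all its multi-infima if $S^\ell=\downarrow\max(S^\ell)$. A meet-multisemilattice is a poset in which every nonempty finite subset has all its multi-infima; a complete meet-multisemilattice is one in which every subset (including $\emptyset$) has all its multi-infima. A pattern setup $(\mathcal{G},(\mathcal{D},\sqsubseteq),\delta)$ ($\mathcal{G}$ a set, $\delta:\mathcal{G}\to\mathcal{D}$) is a pattern multistructure if for every $A\subseteq\mathcal{G}$ the set $\{\delta(g)\mid g\in A\}$ has all its multi-infima, i.e. $cov(A)=\downarrow\max(cov(A))$ where $cov(A)=\{d\in\mathcal{D}\mid\forall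 g\in A,\ d\sqsubseteq\delta(g)\}$. -}

module Defs where

open import Level using (Level; _⊔_)
open import Relation.Binary.Bundles using (Poset)
open import Relation.Unary using (Pred)
open import Data.Product using (_×_; ∃; Σ)
open import Data.Nat using (ℕ; suc)
open import Data.Fin using (Fin)
open import Data.Fin.Subset using (Subset; _∈_)
open import Relation.Binary.PropositionalEquality using (_≡_)

module _ {c ℓ₁ ℓ₂ : Level} (P : Poset c ℓ₁ ℓ₂) where
  open Poset P

  LowerBounds : ∀ {s} → Pred Carrier s → Pred Carrier (c ⊔ ℓ₂ ⊔ s)
  LowerBounds S x = ∀ y → S y → x ≤ y

  Max : ∀ {s} → Pred Carrier s → Pred Carrier (c ⊔ ℓ₁ ⊔ ℓ₂ ⊔ s)
  Max X x = X x × (∀ y → X y → x ≤ y → x ≈ y)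

  Down : ∀ {s} → Pred Carrier s → Pred Carrier (c ⊔ ℓ₂ ⊔ s)
  Down X y = ∃ λ x → X x × y ≤ x

  IsDownMax : ∀ {s} → Pred Carrier s → Set (c ⊔ ℓ₁ ⊔ ℓ₂ ⊔ s)
  IsDownMax X = ∀ x → (X x → Down (Max X) x) × (Down (Max X) x → X x)

  Whole : Pred Carrier c
  Whole _ = Carrier

  HasAllMultiInfima : ∀ {s} → Pred Carrier s → Set (c ⊔ ℓ₁ ⊔ ℓ₂ ⊔ s)
  HasAllMultiInfima S = IsDownMax (LowerBounds S)

  -- a nonempty finite subset of D, given as the image of an enumeration Fin (suc n) → D
  FinImage : ∀ {n} → (Fin (suc n) → Carrier) → Pred Carrier c
  FinImage f d = ∃ λ i → f i ≡ d

  IsMeetMultisemilattice : Set (c ⊔ ℓ₁ ⊔ ℓ₂)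
  IsMeetMultisemilattice = ∀ n (f : Fin (suc n) → Carrier) → HasAllMultiInfima (FinImage f)

  IsCompleteMeetMultisemilattice : Set (Level.suc (c ⊔ ℓ₁ ⊔ ℓ₂))
  IsCompleteMeetMultisemilattice = (S : Pred Carrier (c ⊔ ℓ₁ ⊔ ℓ₂)) → HasAllMultiInfima S

  cov : ∀ {g s} {G : Set g} → (G → Carrier) → Pred G s → Pred Carrier (ℓ₂ ⊔ g ⊔ s)
  cov δ A d = ∀ x → A x → d ≤ δ x

  IsPatternMultistructure : ∀ {g} (G : Set g) → (G → Carrier) → Set (Level.suc (c ⊔ ℓ₁ ⊔ ℓ₂) ⊔ g)
  IsPatternMultistructure G δ = (A : Pred G (c ⊔ ℓ₁ ⊔ ℓ₂)) → IsDownMax (cov δ A)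

  covFin : ∀ {n} → (Fin n → Carrier) → Subset n → Pred Carrier ℓ₂
  covFin δ A d = ∀ x → x ∈ A → d ≤ δ x

  IsFinPatternMultistructure : ∀ {n} → (Fin n → Carrier) → Set (c ⊔ ℓ₁ ⊔ ℓ₂)
  IsFinPatternMultistructure {n} δ = (A : Subset n) → IsDownMax (covFin δ A)

  AllFinitePatternMultistructures : Set (c ⊔ ℓ₁ ⊔ ℓ₂)
  AllFinitePatternMultistructures = ∀ n (δ : Fin (suc n) → Carrier) → IsFinPatternMultistructure δ

  AllPatternMultistructures : Set (Level.suc (c ⊔ ℓ₁ ⊔ ℓ₂))
  AllPatternMultistructures = (G : Set c) → G → (δ : G → Carrier) → IsPatternMultistructure G δ

module Submission where

-- Everything in Theorem 7.7 reduces to one observation: for a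
-- map δ : G → D and A ⊆ G, the cover cov(A) is exactly the set of lower
-- bounds of the image δ[A].  Hence "(G, D, δ) is a pattern multistructure"
-- says that every image δ[A] has all its multi-infima, and the property
-- "X = ↓max(X)" only depends on X up to extensional equality.
--   (2) Images of subsets of nonempty sets G are arbitrary subsets of D
--       (take G = D, δ = id), which gives both directions at once.
--   (1) Images of subsets of a nonempty finite G are either empty, whose
--       lower-bound set is all of D, or nonempty finite sets, which can be
--       re-enumerated by Fin (suc n) by retracting G onto A.  Conversely
--       A = ⊤ yields every finite enumeration, and A = ∅ yields D itself.

open import Defs
open import Level using (Level; _⊔_)
open import Relation.Binary.Bundles using (Poset)
open import Data.Product using (_×_; _,_; proj₁; proj₂; ∃)
open import Function.Bundles using (_⇔_; mk⇔)
open import Relation.Unary using (Pred; _⊆_; _≐_)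
open import Relation.Unary.Properties using (≐-sym; ≐-trans)
open import Relation.Nullary using (yes; no; contradiction; ¬_)
open import Relation.Binary.PropositionalEquality using (_≡_; refl; sym; subst)
open import Data.Nat using (ℕ; suc)
open import Data.Fin using (Fin)
open import Data.Fin.Subset using (Subset; _∈_; ⊤; ⊥)
open import Data.Fin.Subset.Properties using (_∈?_; nonempty?; ∈⊤; ∉⊥)

-- Retraction of Fin m onto a subset A containing a chosen point i₀: the
-- identity on A, constant i₀ outside.  Used to enumerate a nonempty finite
-- subset by the whole of Fin m.
module Retraction {m : ℕ} (A : Subset m) {i₀ : Fin m} (i₀∈A : i₀ ∈ A) where

  retract : Fin m → Fin m
  retract i with i ∈? A
  ... | yes _ = i
  ... | no _  = i₀

  retract-∈ : ∀ i → retract i ∈ A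
  retract-∈ i with i ∈? A
  ... | yes i∈A = i∈A
  ... | no _    = i₀∈A

  retract-fix : ∀ {i} → i ∈ A → retract i ≡ i
  retract-fix {i} i∈A with i ∈? A
  ... | yes _   = refl
  ... | no i∉A  = contradiction i∈A i∉A

module _ {c ℓ₁ ℓ₂ : Level} (P : Poset c ℓ₁ ℓ₂) where
  open Poset P using (Carrier; _≤_)

  Image : ∀ {g s} {G : Set g} → (G → Carrier) → Pred G s → Pred Carrier (c ⊔ g ⊔ s)
  Image δ A d = ∃ λ x → A x × δ x ≡ d

  Down-mono : ∀ {s t} {X : Pred Carrier s} {Y : Pred Carrier t} →
    X ⊆ Y → Down P X ⊆ Down P Y
  Down-mono X⊆Y (m , Xm , x≤m) = m , X⊆Y Xm , x≤m

  Max-resp-≐ : ∀ {s t} {X : Pred Carrier s} {Y : Pred Carrier t} →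
    X ≐ Y → Max P X ⊆ Max P Y
  Max-resp-≐ (X⊆Y , Y⊆X) (Xm , maximal) =
    X⊆Y Xm , λ y Yy m≤y → maximal y (Y⊆X Yy) m≤y

  IsDownMax-resp-≐ : ∀ {s t} {X : Pred Carrier s} {Y : Pred Carrier t} →
    X ≐ Y → IsDownMax P X → IsDownMax P Y
  IsDownMax-resp-≐ X≐Y@(X⊆Y , Y⊆X) X-downMax x =
      (λ Yx → Down-mono (Max-resp-≐ X≐Y) (proj₁ (X-downMax x) (Y⊆X Yx)))
    , (λ below → X⊆Y (proj₂ (X-downMax x) (Down-mono (Max-resp-≐ (≐-sym X≐Y)) below)))

  LowerBounds-antitone : ∀ {s t} {S : Pred Carrier s} {T : Pred Carrier t} →
    S ⊆ T → LowerBounds P T ⊆ LowerBounds P S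
  LowerBounds-antitone S⊆T lb y Sy = lb y (S⊆T Sy)

  LowerBounds-resp-≐ : ∀ {s t} {S : Pred Carrier s} {T : Pred Carrier t} →
    S ≐ T → LowerBounds P S ≐ LowerBounds P T
  LowerBounds-resp-≐ (S⊆T , T⊆S) = LowerBounds-antitone T⊆S , LowerBounds-antitone S⊆T

  LowerBounds-empty : ∀ {s} {S : Pred Carrier s} →
    (∀ y → ¬ S y) → LowerBounds P S ≐ Whole P
  LowerBounds-empty S-empty = (λ {d} _ → d) , λ _ y Sy → contradiction Sy (S-empty y)

  cov≐LowerBounds-Image : ∀ {g s} {G : Set g} (δ : G → Carrier) (A : Pred G s) →
    cov P δ A ≐ LowerBounds P (Image δ A)
  cov≐LowerBounds-Image δ A =
      (λ {d} covers y (x , Ax , δx≡y) → subst (d ≤_) δx≡y (covers x Ax))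
    , (λ lb x Ax → lb _ (x , Ax , refl))

  FinImage≐Image-⊤ : ∀ {n} (f : Fin (suc n) → Carrier) →
    FinImage P f ≐ Image f (_∈ ⊤)
  FinImage≐Image-⊤ f = (λ (i , fi≡d) → i , ∈⊤ , fi≡d) , (λ (i , _ , fi≡d) → i , fi≡d)

  FinImage-retract≐Image : ∀ {n} (δ : Fin (suc n) → Carrier) (A : Subset (suc n))
    {i₀ : Fin (suc n)} (i₀∈A : i₀ ∈ A) →
    FinImage P (λ i → δ (Retraction.retract A i₀∈A i)) ≐ Image δ (_∈ A)
  FinImage-retract≐Image δ A i₀∈A =
      (λ (i , eq) → retract i , retract-∈ i , eq)
    , (λ {d} (i , i∈A , δi≡d) → i , subst (λ j → δ j ≡ d) (sym (retract-fix i∈A)) δi≡d)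
    where open Retraction A i₀∈A

  -- (1) ⇒: A = ⊤ gives every finite enumeration; A = ∅ over a singleton gives D itself.
  finite-patterns⇒meet-multisemilattice :
    AllFinitePatternMultistructures P → IsMeetMultisemilattice P × IsDownMax P (Whole P)
  finite-patterns⇒meet-multisemilattice patterns = meet-multisemilattice , whole-downMax
    where
    meet-multisemilattice : IsMeetMultisemilattice P
    meet-multisemilattice n f = IsDownMax-resp-≐
      (≐-trans (cov≐LowerBounds-Image f (_∈ ⊤)) (≐-sym (LowerBounds-resp-≐ (FinImage≐Image-⊤ f))))
      (patterns n f ⊤)

    whole-downMax : IsDownMax P (Whole P)
    whole-downMax x = IsDownMax-resp-≐
      (≐-trans (cov≐LowerBounds-Image δ (_∈ ⊥)) (LowerBounds-empty λ _ (_ , i∈⊥ , _) → ∉⊥ i∈⊥))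
      (patterns 0 δ ⊥) x
      where
      δ : Fin 1 → Carrier
      δ _ = x

  -- (1) ⇐: an empty A has cover D; a nonempty A has cover the lower bounds
  -- of the finite enumeration δ ∘ retract.
  meet-multisemilattice⇒finite-patterns :
    IsMeetMultisemilattice P × IsDownMax P (Whole P) → AllFinitePatternMultistructures P
  meet-multisemilattice⇒finite-patterns (meet-multisemilattice , whole-downMax) n δ A
    with nonempty? A
  ... | yes (i₀ , i₀∈A) = IsDownMax-resp-≐
      (≐-trans (LowerBounds-resp-≐ (FinImage-retract≐Image δ A i₀∈A))
               (≐-sym (cov≐LowerBounds-Image δ (_∈ A))))
      (meet-multisemilattice n (λ i → δ (Retraction.retract A i₀∈A i)))
  ... | no A-empty = IsDownMax-resp-≐
      (≐-sym (≐-trans (cov≐LowerBounds-Image δ (_∈ A))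
                      (LowerBounds-empty λ _ (i , i∈A , _) → A-empty (i , i∈A))))
      whole-downMax

  -- (2) ⇒: every S ⊆ D is the image of itself under the identity of G = D.
  patterns⇒complete : AllPatternMultistructures P → IsCompleteMeetMultisemilattice P
  patterns⇒complete patterns S x = patterns Carrier x (λ d → d) S x

  complete⇒patterns : IsCompleteMeetMultisemilattice P → AllPatternMultistructures P
  complete⇒patterns complete G _ δ A =
    IsDownMax-resp-≐ (≐-sym (cov≐LowerBounds-Image δ A)) (complete (Image δ A))

theorem7p7 : ∀ {c ℓ₁ ℓ₂ : Level} (P : Poset c ℓ₁ ℓ₂) →
    (AllFinitePatternMultistructures P ⇔ (IsMeetMultisemilattice P × IsDownMax P (Whole P)))
    × (AllPatternMultistructures P ⇔ IsCompleteMeetMultisemilattice P)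
theorem7p7 P =
    mk⇔ (finite-patterns⇒meet-multisemilattice P) (meet-multisemilattice⇒finite-patterns P)
  , mk⇔ (patterns⇒complete P) (complete⇒patterns P)
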